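{- Let $\mathcal{F}$ be a finite family of finite sets and let $A\in\mathcal{F}$ be a member set containing at least one element of frequency one in $\mathcal{F}$. Suppose that every $S\in\mathcal{F}$ with $S\cap A\neq\emptyset$ contains an element of frequency one in $\mathcal{F}$. Then $\langle\mathcal{F}\rangle$ satisfies the union closed conjecture, and every element of $A$ is abundant in $\langle\mathcal{F}\rangle$.
   Context: For a family of sets $\mathcal{F}$, its universe $U(\mathcal{F})$ is the union of its member sets, and the frequency of an element $x$ in $\mathcal{F}$ is the number of member sets of $\mathcal{F}$ containing $x$. $\langle\mathcal{F}\rangle$ is the union-closed family generated by $\mathcal{F}$: all unions of subfamilies of $\mathcal{F}$, including the empty set. An element $x$ is abundant in a family $\mathcal{U}$ if its frequency in $\mathcal{U}$ is at least $|\mathcal{U}|/2$. A finite union-closed family $\mathcal{U}$ satisfies the union closed conjecture if either $\mathcal{U}=\{\emptyset\}$ or some element of $U(\mathcal{U})$ is abundant in $\mathcal{U}$. -}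

module Defs where

open import Data.Nat using (ℕ; zero; suc; _*_; _≥_)
open import Data.Bool using (Bool; true; false)
open import Data.Fin using (Fin)
open import Data.Fin.Subset using (Subset; ⋃; _∈_; inside; outside)
open import Data.Fin.Subset.Properties using (_∈?_)
open import Data.List using (List; []; _∷_; map; filter; length; deduplicate; _++_)
open import Data.List.Membership.Propositional renaming (_∈_ to _∈ˡ_)
open import Data.Vec using (Vec; []; _∷_)
open import Data.Vec.Properties using (≡-dec)
open import Data.Product using (_×_; ∃-syntax)
open import Data.Sum using (_⊎_)
open import Relation.Binary.PropositionalEquality using (_≡_)
open import Relation.Binary.Definitions using (DecidableEquality)
import Data.List as L

-- A finite family of finite sets: the ground set is Fin n, and a family with
-- m member sets is an indexing  F : Fin m → Subset n  which is injective
-- (member sets are pairwise distinct).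
-- Families that are themselves the result of a construction are
-- represented as duplicate-free lists of subsets.

_≟ˢ_ : ∀ {n} → DecidableEquality (Subset n)
_≟ˢ_ = ≡-dec Data.Bool._≟_

allSubsets : (m : ℕ) → List (Subset m)
allSubsets zero = [] ∷ []
allSubsets (suc m) = map (inside ∷_) (allSubsets m) ++ map (outside ∷_) (allSubsets m)

members : ∀ {m n} → (Fin m → Subset n) → List (Subset n)
members {m} F = map F (L.allFin m)

subUnion : ∀ {m n} → (Fin m → Subset n) → Subset m → Subset n
subUnion {m} F I = ⋃ (map F (filter (_∈? I) (L.allFin m)))

-- ⟨ F ⟩ : all unions of subfamilies of F (including the empty union ∅),
-- as a duplicate-free list
⟨_⟩ : ∀ {m n} → (Fin m → Subset n) → List (Subset n)
⟨_⟩ {m} F = deduplicate _≟ˢ_ (map (subUnion F) (allSubsets m))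

freq : ∀ {n} → Fin n → List (Subset n) → ℕ
freq x 𝓤 = length (filter (x ∈?_) 𝓤)

freqF : ∀ {m n} → Fin n → (Fin m → Subset n) → ℕ
freqF x F = freq x (members F)

universe : ∀ {n} → List (Subset n) → Subset n
universe 𝓤 = ⋃ 𝓤

Abundant : ∀ {n} → Fin n → List (Subset n) → Set
Abundant x 𝓤 = 2 * freq x 𝓤 ≥ length 𝓤

SatisfiesUCC : ∀ {n} → List (Subset n) → Set
SatisfiesUCC {n} 𝓤 =
  (∀ S → S ∈ˡ 𝓤 → S ≡ Data.Fin.Subset.⊥) × (Data.Fin.Subset.⊥ ∈ˡ 𝓤)
  ⊎ ∃[ x ] (x ∈ universe 𝓤 × Abundant x 𝓤)

-- Let A = F a and y ∈ A.  The map U ↦ U ∪ A sends the members of ⟨F⟩ avoiding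
-- y injectively to members containing y, so y is abundant.  Injectivity: let
-- U ∪ A = U' ∪ A with y ∉ U, and let F i be a generator of U.  If F i meets A,
-- it has an element z of frequency one; z ∉ A, since otherwise F i = A ∋ y,
-- so z ∈ U' and the only member set containing z, namely F i, is a generator
-- of U'.  Hence every element of U lies in U' (or outside A and then in U').
module Submission where

open import Defs
open import Data.Nat using (ℕ)
open import Data.Fin using (Fin)
open import Data.Fin.Subset using (Subset; _∈_)
open import Data.Product using (_×_; ∃-syntax)
open import Relation.Binary.PropositionalEquality using (_≡_)
open import Function.Definitions using (Injective)

open import Data.Nat using (zero; suc; _+_; _*_; _≤_; z≤n; s≤s)
open import Data.Nat.Properties using (+-suc; +-identityʳ; +-monoʳ-≤; ≤-trans; <-irrefl; module ≤-Reasoning)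
import Data.Fin as Fin
open import Data.Vec using ([]; _∷_)
open import Data.Fin.Subset using (_∉_; _∪_; ⋃; ⁅_⁆; _⊆_; inside; outside)
open import Data.Fin.Subset.Properties
  using (_∈?_; p⊆p∪q; x∈p∪q⁻; x∈p∪q⁺; ∉⊥; ⊆-antisym; x∈⁅x⁆; x∈⁅y⁆⇒x≡y)
open import Data.List using (List; []; _∷_; map; filter; length)
import Data.List as L
open import Data.List.Membership.Propositional using () renaming (_∈_ to _∈ˡ_)
open import Data.List.Membership.Propositional.Properties
  using (∈-filter⁺; ∈-filter⁻; ∈-map⁺; ∈-map⁻; ∈-++⁺ˡ; ∈-++⁺ʳ; ∈-allFin)
open import Data.List.Properties using (filter-notAll; length-map)
open import Data.List.Relation.Binary.Subset.Propositional using () renaming (_⊆_ to _⊆ˡ_)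
open import Data.List.Relation.Unary.Any using (here; there)
import Data.List.Relation.Unary.Any as Any
import Data.List.Relation.Unary.Any.Properties as Any
import Data.List.Relation.Unary.All as All
open import Data.List.Relation.Unary.AllPairs using ([]; _∷_)
open import Data.List.Relation.Unary.Unique.Propositional using (Unique)
import Data.List.Relation.Unary.Unique.Propositional.Properties as Unique
open import Data.List.Relation.Unary.Unique.DecPropositional.Properties using (deduplicate-!)
open import Data.Product using (_,_; proj₂; uncurry)
open import Data.Sum using (inj₁; inj₂)
open import Data.Empty using (⊥-elim)
open import Relation.Nullary using (¬_; yes; no; ¬?; contradiction)
open import Relation.Unary using (Pred; Decidable)
open import Relation.Unary.Properties using (∁?)
open import Relation.Binary.Definitions using (DecidableEquality)
open import Relation.Binary.PropositionalEquality using (refl; sym; trans; cong; subst)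

module _ {A : Set} (_≟_ : DecidableEquality A) where

  Unique-length-≤ : ∀ {xs ys : List A} → Unique xs → xs ⊆ˡ ys → length xs ≤ length ys
  Unique-length-≤ {[]}     _          _   = z≤n
  Unique-length-≤ {x ∷ xs} {ys} (x∉xs ∷ xs!) xs⊆ys =
    ≤-trans (s≤s (Unique-length-≤ xs! xs⊆ys-x))
            (filter-notAll ≢x? ys (Any.map (λ { refl x≢x → x≢x refl }) (xs⊆ys (here refl))))
    where
    ≢x? : Decidable (λ y → ¬ x ≡ y)
    ≢x? y = ¬? (x ≟ y)
    xs⊆ys-x : xs ⊆ˡ filter ≢x? ys
    xs⊆ys-x z∈xs = ∈-filter⁺ ≢x? (xs⊆ys (there z∈xs)) (All.lookup x∉xs z∈xs)

length-filter+length-filter-∁ : ∀ {A : Set} {ℓ} {P : Pred A ℓ} (P? : Decidable P) (xs : List A) →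
  length (filter P? xs) + length (filter (∁? P?) xs) ≡ length xs
length-filter+length-filter-∁ P? [] = refl
length-filter+length-filter-∁ P? (x ∷ xs) with P? x
... | yes _ = cong suc (length-filter+length-filter-∁ P? xs)
... | no  _ = trans (+-suc _ _) (cong suc (length-filter+length-filter-∁ P? xs))

Unique-map⁺-injectiveOn : ∀ {A B : Set} (f : A → B) {xs : List A} → Unique xs →
  (∀ {x y} → x ∈ˡ xs → y ∈ˡ xs → f x ≡ f y → x ≡ y) → Unique (map f xs)
Unique-map⁺-injectiveOn f {[]}     _            _   = []
Unique-map⁺-injectiveOn f {x ∷ xs} (x∉xs ∷ xs!) inj =
  All.tabulate fx∉ ∷ Unique-map⁺-injectiveOn f xs! (λ p q → inj (there p) (there q))
  where
  fx∉ : ∀ {w} → w ∈ˡ map f xs → ¬ f x ≡ w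
  fx∉ w∈ fx≡w with ∈-map⁻ f w∈
  ... | z , z∈xs , refl = All.lookup x∉xs z∈xs (inj (here refl) (there z∈xs) fx≡w)

∈⋃⁻ : ∀ {n} {x : Fin n} (𝓢 : List (Subset n)) → x ∈ ⋃ 𝓢 → ∃[ S ] (S ∈ˡ 𝓢 × x ∈ S)
∈⋃⁻ []      x∈⋃ = ⊥-elim (∉⊥ x∈⋃)
∈⋃⁻ (S ∷ 𝓢) x∈⋃ with x∈p∪q⁻ S (⋃ 𝓢) x∈⋃
... | inj₁ x∈S = S , here refl , x∈S
... | inj₂ x∈⋃𝓢 with ∈⋃⁻ 𝓢 x∈⋃𝓢
...   | T , T∈𝓢 , x∈T = T , there T∈𝓢 , x∈T

∈⋃⁺ : ∀ {n} {x : Fin n} {S : Subset n} {𝓢 : List (Subset n)} → S ∈ˡ 𝓢 → x ∈ S → x ∈ ⋃ 𝓢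
∈⋃⁺ (here refl) x∈S = x∈p∪q⁺ (inj₁ x∈S)
∈⋃⁺ (there S∈𝓢) x∈S = x∈p∪q⁺ (inj₂ (∈⋃⁺ S∈𝓢 x∈S))

abundant-by-injection : ∀ {n : ℕ} (x : Fin n) {𝓤 : List (Subset n)} → Unique 𝓤 →
  (f : Subset n → Subset n) →
  (∀ {U} → U ∈ˡ 𝓤 → x ∉ U → f U ∈ˡ 𝓤 × x ∈ f U) →
  (∀ {U V} → U ∈ˡ 𝓤 → x ∉ U → V ∈ˡ 𝓤 → x ∉ V → f U ≡ f V → U ≡ V) →
  Abundant x 𝓤
abundant-by-injection {n} x {𝓤} 𝓤! f f-into f-inj = begin
  length 𝓤                        ≡⟨ sym (length-filter+length-filter-∁ (x ∈?_) 𝓤) ⟩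
  freq x 𝓤 + length without       ≤⟨ +-monoʳ-≤ (freq x 𝓤) without≤with ⟩
  freq x 𝓤 + freq x 𝓤             ≡⟨ cong (freq x 𝓤 +_) (sym (+-identityʳ (freq x 𝓤))) ⟩
  2 * freq x 𝓤                    ∎
  where
  open ≤-Reasoning
  without : List (Subset n)
  without = filter (∁? (x ∈?_)) 𝓤
  ∈without⁻ : ∀ {U} → U ∈ˡ without → U ∈ˡ 𝓤 × x ∉ U
  ∈without⁻ = ∈-filter⁻ (∁? (x ∈?_))
  f[without]⊆with : map f without ⊆ˡ filter (x ∈?_) 𝓤
  f[without]⊆with w∈ with ∈-map⁻ f w∈
  ... | U , U∈ , refl = let fU∈𝓤 , x∈fU = uncurry f-into (∈without⁻ U∈) in ∈-filter⁺ (x ∈?_) fU∈𝓤 x∈fU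
  without≤with : length without ≤ freq x 𝓤
  without≤with = subst (_≤ freq x 𝓤) (length-map f without)
    (Unique-length-≤ _≟ˢ_
      (Unique-map⁺-injectiveOn f (Unique.filter⁺ (∁? (x ∈?_)) 𝓤!)
        (λ U∈ V∈ → uncurry (uncurry f-inj (∈without⁻ U∈)) (∈without⁻ V∈)))
      f[without]⊆with)

allSubsets-complete : ∀ m (I : Subset m) → I ∈ˡ allSubsets m
allSubsets-complete zero    []            = here refl
allSubsets-complete (suc m) (inside ∷ I)  = ∈-++⁺ˡ (∈-map⁺ (inside ∷_) (allSubsets-complete m I))
allSubsets-complete (suc m) (outside ∷ I) =
  ∈-++⁺ʳ (map (inside ∷_) (allSubsets m)) (∈-map⁺ (outside ∷_) (allSubsets-complete m I))

module _ {m n : ℕ} (F : Fin m → Subset n) where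

  private
    generators : Subset m → List (Subset n)
    generators I = map F (filter (_∈? I) (L.allFin m))

  ∈subUnion⁻ : ∀ I {x} → x ∈ subUnion F I → ∃[ i ] (i ∈ I × x ∈ F i)
  ∈subUnion⁻ I x∈ with ∈⋃⁻ (generators I) x∈
  ... | S , S∈ , x∈S with ∈-map⁻ F S∈
  ...   | i , i∈ , refl = i , proj₂ (∈-filter⁻ (_∈? I) {xs = L.allFin m} i∈) , x∈S

  F⊆subUnion : ∀ {I i} → i ∈ I → F i ⊆ subUnion F I
  F⊆subUnion {I} {i} i∈I =
    ∈⋃⁺ {𝓢 = generators I} (∈-map⁺ F (∈-filter⁺ (_∈? I) (∈-allFin i) i∈I))

  subUnion-∪-⁅⁆ : ∀ I a → subUnion F I ∪ F a ≡ subUnion F (I ∪ ⁅ a ⁆)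
  subUnion-∪-⁅⁆ I a = ⊆-antisym lhs⊆rhs rhs⊆lhs
    where
    lhs⊆rhs : subUnion F I ∪ F a ⊆ subUnion F (I ∪ ⁅ a ⁆)
    lhs⊆rhs x∈ with x∈p∪q⁻ (subUnion F I) (F a) x∈
    ... | inj₂ x∈Fa = F⊆subUnion (x∈p∪q⁺ (inj₂ (x∈⁅x⁆ a))) x∈Fa
    ... | inj₁ x∈U with ∈subUnion⁻ I x∈U
    ...   | i , i∈I , x∈Fi = F⊆subUnion (x∈p∪q⁺ (inj₁ i∈I)) x∈Fi
    rhs⊆lhs : subUnion F (I ∪ ⁅ a ⁆) ⊆ subUnion F I ∪ F a
    rhs⊆lhs x∈ with ∈subUnion⁻ (I ∪ ⁅ a ⁆) x∈
    ... | i , i∈ , x∈Fi with x∈p∪q⁻ I ⁅ a ⁆ i∈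
    ...   | inj₁ i∈I = x∈p∪q⁺ (inj₁ (F⊆subUnion i∈I x∈Fi))
    ...   | inj₂ i∈⁅a⁆ with x∈⁅y⁆⇒x≡y a i∈⁅a⁆
    ...     | refl = x∈p∪q⁺ (inj₂ x∈Fi)

  ∈⟨⟩⁻ : ∀ {U} → U ∈ˡ ⟨ F ⟩ → ∃[ I ] (U ≡ subUnion F I)
  ∈⟨⟩⁻ U∈ with ∈-map⁻ (subUnion F) (Any.deduplicate⁻ _≟ˢ_ U∈)
  ... | I , _ , U≡ = I , U≡

  subUnion∈⟨⟩ : ∀ I → subUnion F I ∈ˡ ⟨ F ⟩
  subUnion∈⟨⟩ I = Any.deduplicate⁺ _≟ˢ_ (λ { refl p → p })
    (∈-map⁺ (subUnion F) (allSubsets-complete m I))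

  ⟨⟩-unique : Unique ⟨ F ⟩
  ⟨⟩-unique = deduplicate-! _≟ˢ_ (map (subUnion F) (allSubsets m))

  ∪-∈⟨⟩ : ∀ {U} a → U ∈ˡ ⟨ F ⟩ → U ∪ F a ∈ˡ ⟨ F ⟩
  ∪-∈⟨⟩ a U∈ with ∈⟨⟩⁻ U∈
  ... | I , refl = subst (_∈ˡ ⟨ F ⟩) (sym (subUnion-∪-⁅⁆ I a)) (subUnion∈⟨⟩ (I ∪ ⁅ a ⁆))

  freqF≡1⇒≡ : Injective _≡_ _≡_ F → ∀ {z i j} → freqF z F ≡ 1 → z ∈ F i → z ∈ F j → i ≡ j
  freqF≡1⇒≡ F-inj {z} {i} {j} fz≡1 z∈Fi z∈Fj with i Fin.≟ j
  ... | yes i≡j = i≡j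
  ... | no  i≢j = contradiction (subst (2 ≤_) fz≡1 (Unique-length-≤ _≟ˢ_ Fi,Fj! Fi,Fj⊆)) (<-irrefl refl)
    where
    Fi,Fj! : Unique (F i ∷ F j ∷ [])
    Fi,Fj! = ((λ Fi≡Fj → i≢j (F-inj Fi≡Fj)) All.∷ All.[]) ∷ All.[] ∷ []
    Fi,Fj⊆ : (F i ∷ F j ∷ []) ⊆ˡ filter (z ∈?_) (members F)
    Fi,Fj⊆ (here refl)         = ∈-filter⁺ (z ∈?_) (∈-map⁺ F (∈-allFin i)) z∈Fi
    Fi,Fj⊆ (there (here refl)) = ∈-filter⁺ (z ∈?_) (∈-map⁺ F (∈-allFin j)) z∈Fj

module _ {m n : ℕ} (F : Fin m → Subset n) (F-inj : Injective _≡_ _≡_ F) (a : Fin m)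
  (meets-a⇒private : ∀ i → ∃[ y ] (y ∈ F i × y ∈ F a) → ∃[ z ] (z ∈ F i × freqF z F ≡ 1))
  where

  private
    shared⇒≡ : ∀ {z i j} → freqF z F ≡ 1 → z ∈ F i → z ∈ F j → i ≡ j
    shared⇒≡ = freqF≡1⇒≡ F F-inj

  ⊆∪-cancelʳ : ∀ {y} I J → y ∈ F a → y ∉ subUnion F I →
    subUnion F I ⊆ subUnion F J ∪ F a → subUnion F I ⊆ subUnion F J
  ⊆∪-cancelʳ {y} I J y∈Fa y∉U U⊆U'∪A {x} x∈U
    with ∈subUnion⁻ F I x∈U | x∈p∪q⁻ (subUnion F J) (F a) (U⊆U'∪A x∈U)
  ... | _              | inj₁ x∈U' = x∈U'
  ... | i , i∈I , x∈Fi | inj₂ x∈Fa with meets-a⇒private i (x , x∈Fi , x∈Fa)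
  ...   | z , z∈Fi , fz≡1 with x∈p∪q⁻ (subUnion F J) (F a) (U⊆U'∪A (F⊆subUnion F i∈I z∈Fi))
  ...     | inj₂ z∈Fa = ⊥-elim (y∉U (F⊆subUnion F (subst (_∈ I) (shared⇒≡ fz≡1 z∈Fi z∈Fa) i∈I) y∈Fa))
  ...     | inj₁ z∈U' with ∈subUnion⁻ F J z∈U'
  ...       | j , j∈J , z∈Fj = F⊆subUnion F (subst (_∈ J) (shared⇒≡ fz≡1 z∈Fj z∈Fi) j∈J) x∈Fi

  abundant-in-⟨⟩ : ∀ y → y ∈ F a → Abundant y ⟨ F ⟩
  abundant-in-⟨⟩ y y∈Fa = abundant-by-injection y (⟨⟩-unique F) (_∪ F a)
    (λ U∈ _ → ∪-∈⟨⟩ F a U∈ , x∈p∪q⁺ (inj₂ y∈Fa))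
    ∪-injective
    where
    ∪-injective : ∀ {U V} → U ∈ˡ ⟨ F ⟩ → y ∉ U → V ∈ˡ ⟨ F ⟩ → y ∉ V → U ∪ F a ≡ V ∪ F a → U ≡ V
    ∪-injective U∈ y∉U V∈ y∉V eq with ∈⟨⟩⁻ F U∈ | ∈⟨⟩⁻ F V∈
    ... | I , refl | J , refl =
      ⊆-antisym (⊆∪-cancelʳ I J y∈Fa y∉U (⊆-∪ʳ eq)) (⊆∪-cancelʳ J I y∈Fa y∉V (⊆-∪ʳ (sym eq)))
      where
      ⊆-∪ʳ : ∀ {U V} → U ∪ F a ≡ V ∪ F a → U ⊆ V ∪ F a
      ⊆-∪ʳ {U} eq = subst (U ⊆_) eq (p⊆p∪q (F a))

proposition3p8 : ∀ {m n : ℕ} (F : Fin m → Subset n) → Injective _≡_ _≡_ F →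
    (a : Fin m) →
    (∃[ x ] (x ∈ F a × freqF x F ≡ 1)) →
    (∀ (i : Fin m) → (∃[ y ] (y ∈ F i × y ∈ F a)) →
      ∃[ z ] (z ∈ F i × freqF z F ≡ 1)) →
    SatisfiesUCC ⟨ F ⟩ × (∀ x → x ∈ F a → Abundant x ⟨ F ⟩)
proposition3p8 F F-inj a (x , x∈Fa , _) meets-a⇒private =
  inj₂ (x , x∈universe , abundant x x∈Fa) , abundant
  where
  abundant : ∀ y → y ∈ F a → Abundant y ⟨ F ⟩
  abundant = abundant-in-⟨⟩ F F-inj a meets-a⇒private
  x∈universe : x ∈ universe ⟨ F ⟩
  x∈universe = ∈⋃⁺ (subUnion∈⟨⟩ F ⁅ a ⁆) (F⊆subUnion F (x∈⁅x⁆ a) x∈Fa)
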